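{- Let $(X,I,Y,R)$ be a polarity with a relation $R$ of sort type $(i_{n+1};i_1\cdots i_n)$ and $k\in\{1,\ldots,n\}$. For Galois sets $E_j\in\mathcal G(Z_{i_j})$ ($j\ne k$) and $G\in\mathcal G(Z_{i_{n+1}})$, let $\beta^k_{R/}(\vec E[G]_k)=\bigcup\{F\in\mathcal G(Z_{i_k}):\alpha_R(\vec E[F]_k)\subseteq G\}$. Then $$\beta^k_{R/}(\vec E[G]_k)=\bigcup\{\Gamma u: u\in Z_{i_k},\ \alpha_R(\vec E[\Gamma u]_k)\subseteq G\}=\{u\in Z_{i_k}:\alpha_R(\vec E[\Gamma u]_k)\subseteq G\}.$$
   Context: A polarity is $(X,I,Y)$, $X,Y$ nonempty, $I\subseteq X\times Y$; $x\perp y$ iff $(x,y)\notin I$; $U^\perp=\{y:x\perp y\ \forall x\in U\}$, ${}^\perp V=\{x:x\perp y\ \forall y\in V\}$. Galois sets: stable $A={}^\perp(A^\perp)\subseteq X$, co-stable $B=({}^\perp B)^\perp\subseteq Y$; $\mathcal G(X),\mathcal G(Y)$ their families. Sorts $Z_1=X$, $Z_\partial=Y$. Preorders: $x\le z$ iff $\{x\}^\perp\subseteq\{z\}^\perp$ on $X$; $y\le v$ iff ${}^\perp\{y\}\subseteq{}^\perp\{v\}$ on $Y$; $\Gamma u=\{w:u\le w\}$. A relation of sort $(i_{n+1};i_1\cdots i_n)$ is $R\subseteq Z_{i_{n+1}}\times\prod_jZ_{i_j}$, $R\vec w=\{w:wR\vec w\}$; $\alpha_R(\vec W)=\bigcup\{R\vec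 w:w_j\in W_j\ \forall j\}$ for $W_j\subseteq Z_{i_j}$. $\vec E[F]_k$ is the tuple with $k$-th entry $F$. -}

module Defs where

open import Level using (0ℓ)
import Level
open import Data.Nat using (ℕ)
open import Data.Fin using (Fin; _≟_)
open import Data.Product using (Σ; _×_; _,_; ∃)
open import Relation.Nullary using (¬_; yes; no)
open import Relation.Unary using (Pred; _⊆_; _≐_)
open import Relation.Binary.PropositionalEquality using (_≡_; subst; sym)

record Polarity : Set₁ where
  field
    X : Set
    Y : Set
    I : X → Y → Set
    x₀ : X
    y₀ : Y

data Sort : Set where
  one ∂ : Sort

module PolarityDefs (P : Polarity) where
  open Polarity P public

  _⊥_ : X → Y → Set
  x ⊥ y = ¬ I x y

  _⊥ᵘ : Pred X 0ℓ → Pred Y 0ℓ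
  (U ⊥ᵘ) y = ∀ x → U x → x ⊥ y

  ⊥ˡ_ : Pred Y 0ℓ → Pred X 0ℓ
  (⊥ˡ V) x = ∀ y → V y → x ⊥ y

  Stable : Pred X 0ℓ → Set
  Stable A = A ≐ ⊥ˡ (A ⊥ᵘ)

  CoStable : Pred Y 0ℓ → Set
  CoStable B = B ≐ ((⊥ˡ B) ⊥ᵘ)

  Z : Sort → Set
  Z one = X
  Z ∂ = Y

  Galois : (i : Sort) → Pred (Z i) 0ℓ → Set
  Galois one A = Stable A
  Galois ∂ B = CoStable B

  _≤⟨_⟩_ : {i : Sort} → Z i → Sort → Z i → Set
  _≤⟨_⟩_ {one} x _ z = ∀ y → x ⊥ y → z ⊥ y
  _≤⟨_⟩_ {∂} y _ v = ∀ x → x ⊥ y → x ⊥ v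

  Γ : (i : Sort) → Z i → Pred (Z i) 0ℓ
  Γ i u w = _≤⟨_⟩_ {i} u i w

  -- A relation of sort (i₀ ; is 0 ⋯ is (n-1)):  R ⊆ Z i₀ × Π_j Z (is j)
  -- (wrapped in a record only so that n, is, i₀ are inferable from R)
  record Rel (n : ℕ) (is : Fin n → Sort) (i₀ : Sort) : Set₁ where
    constructor mkRel
    field rel : Z i₀ → ((j : Fin n) → Z (is j)) → Set
  open Rel public

  α : {n : ℕ} {is : Fin n → Sort} {i₀ : Sort} → Rel n is i₀ →
      ((j : Fin n) → Pred (Z (is j)) 0ℓ) → Pred (Z i₀) 0ℓ
  α {n} {is} R W w = Σ ((j : Fin n) → Z (is j)) λ ws → (∀ j → W j (ws j)) × rel R w ws

  upd : {n : ℕ} (is : Fin n → Sort) → ((j : Fin n) → Pred (Z (is j)) 0ℓ) →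
        (k : Fin n) → Pred (Z (is k)) 0ℓ → (j : Fin n) → Pred (Z (is j)) 0ℓ
  upd is E k F j with j ≟ k
  ... | yes j≡k = subst (λ m → Pred (Z (is m)) 0ℓ) (sym j≡k) F
  ... | no _ = E j

  βR/ : {n : ℕ} {is : Fin n → Sort} {i₀ : Sort} → Rel n is i₀ →
        (k : Fin n) → ((j : Fin n) → Pred (Z (is j)) 0ℓ) → Pred (Z i₀) 0ℓ →
        Pred (Z (is k)) (Level.suc 0ℓ)
  βR/ {n} {is} {i₀} R k E G u =
    Σ (Pred (Z (is k)) 0ℓ) λ F → Galois (is k) F ×
      (α {n} {is} {i₀} R (upd is E k F) ⊆ G) × F u

{-# OPTIONS --safe #-}
module Submission where

-- Every Galois set is an up-set for the preorder ≤, and every principal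
-- up-set Γ u is itself a Galois set (Γ u = ⊥({u}⊥) on X, dually on Y).
-- Since α_R is monotone in each argument, a Galois F with u ∈ F and
-- α_R(E⃗[F]_k) ⊆ G can be shrunk to Γ u ⊆ F, so the union defining β
-- may be taken over principal up-sets only; and u ∈ Γ u turns that union
-- into the set of its generators u.

open import Defs
open import Data.Nat using (ℕ)
open import Data.Fin using (Fin; _≟_)
open import Data.Product using (Σ; _×_; _,_)
open import Relation.Nullary using (¬_; yes; no)
open import Relation.Unary using (Pred; _⊆_; _≐_)
open import Relation.Binary.PropositionalEquality using (_≡_; refl)
open import Level using (0ℓ)
open import Function using (_∘_)

module Principal (P : Polarity) where
  open PolarityDefs P

  Γ-refl : ∀ i (u : Z i) → Γ i u u
  Γ-refl one u y u⊥y = u⊥y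
  Γ-refl ∂  u x x⊥u = x⊥u

  Γ-galois : ∀ i (u : Z i) → Galois i (Γ i u)
  Γ-galois one u = (λ u≤w y y∈Γ⊥ → y∈Γ⊥ _ u≤w)
                 , (λ w∈⊥Γ⊥ y u⊥y → w∈⊥Γ⊥ y (λ z u≤z → u≤z y u⊥y))
  Γ-galois ∂  u = (λ u≤w x x∈⊥Γ → x∈⊥Γ _ u≤w)
                 , (λ w∈⊥Γ⊥ x x⊥u → w∈⊥Γ⊥ x (λ z u≤z → u≤z x x⊥u))

  Galois⇒upClosed : ∀ i {F : Pred (Z i) 0ℓ} → Galois i F → ∀ {u} → F u → Γ i u ⊆ F
  Galois⇒upClosed one (F⊆ , ⊆F) u∈F u≤w = ⊆F (λ y y∈F⊥ → u≤w y (F⊆ u∈F y y∈F⊥))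
  Galois⇒upClosed ∂  (F⊆ , ⊆F) u∈F u≤w = ⊆F (λ x x∈⊥F → u≤w x (F⊆ u∈F x x∈⊥F))

  upd-mono : ∀ {n} (is : Fin n → Sort) (E : (j : Fin n) → Pred (Z (is j)) 0ℓ) (k : Fin n)
             {F F′ : Pred (Z (is k)) 0ℓ} → F ⊆ F′ → ∀ j → upd is E k F j ⊆ upd is E k F′ j
  upd-mono is E k F⊆F′ j with j ≟ k
  ... | yes refl = F⊆F′
  ... | no _     = λ e → e

  α-mono : ∀ {n} {is : Fin n → Sort} {i₀} (R : Rel n is i₀)
           {W W′ : (j : Fin n) → Pred (Z (is j)) 0ℓ} → (∀ j → W j ⊆ W′ j) → α R W ⊆ α R W′
  α-mono R W⊆W′ (ws , ws∈W , r) = ws , (λ j → W⊆W′ j (ws∈W j)) , r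

  module _ {n} {is : Fin n → Sort} {i₀} (R : Rel n is i₀) (k : Fin n)
           (E : (j : Fin n) → Pred (Z (is j)) 0ℓ) (G : Pred (Z i₀) 0ℓ) where

    βR/⇒αΓ⊆ : ∀ {u} → βR/ R k E G u → α R (upd is E k (Γ (is k) u)) ⊆ G
    βR/⇒αΓ⊆ (F , F-galois , αF⊆G , u∈F) =
      αF⊆G ∘ α-mono R (upd-mono is E k (Galois⇒upClosed (is k) F-galois u∈F))

    αΓ⊆⇒Γ⊆βR/ : ∀ {u} → α R (upd is E k (Γ (is k) u)) ⊆ G → Γ (is k) u ⊆ βR/ R k E G
    αΓ⊆⇒Γ⊆βR/ {u} αΓ⊆G u≤w = Γ (is k) u , Γ-galois (is k) u , αΓ⊆G , u≤w

lemma3p15 : (P : Polarity) → let open PolarityDefs P in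
    (n : ℕ) (is : Fin n → Sort) (i₀ : Sort) (R : Rel n is i₀) (k : Fin n)
    (E : (j : Fin n) → Z (is j) → Set) (G : Z i₀ → Set) →
    (∀ j → ¬ (j ≡ k) → Galois (is j) (E j)) → Galois i₀ G →
    (βR/ R k E G ≐ (λ w → Σ (Z (is k)) λ u → (α R (upd is E k (Γ (is k) u)) ⊆ G) × Γ (is k) u w))
    × (βR/ R k E G ≐ (λ u → α R (upd is E k (Γ (is k) u)) ⊆ G))
lemma3p15 P n is i₀ R k E G _ _ =
    ( (λ {u} u∈β → u , βR/⇒αΓ⊆ R k E G u∈β , Γ-refl (is k) u)
    , (λ { (u , αΓ⊆G , u≤w) → αΓ⊆⇒Γ⊆βR/ R k E G αΓ⊆G u≤w }) )
  , ( βR/⇒αΓ⊆ R k E G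
    , (λ {u} αΓ⊆G → αΓ⊆⇒Γ⊆βR/ R k E G αΓ⊆G (Γ-refl (is k) u)) )
  where open Principal P
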